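{- Let $H$ be a graph in which every edge is incident to a vertex of degree at most $2$, and let $G$ be any graph. If $G$ contains $H$ as an induced minor but no proper induced subgraph of $G$ contains $H$ as an induced minor, then the degeneracy of $G$ is at most $3\cdot|V(H)|$.
   Context: $G$ contains $H$ as an induced minor if $H$ can be obtained from $G$ by vertex deletions and edge contractions. The degeneracy of $G$ is the least $\delta$ such that the vertices of $G$ can be ordered so that each vertex has at most $\delta$ neighbors earlier in the order. -}

module Defs where

open import Data.Nat using (ℕ; zero; suc; _≤_; _<ᵇ_)
open import Data.Fin using (Fin; toℕ) renaming (zero to fz; suc to fs)
open import Data.Bool using (Bool; true; false; _∧_; if_then_else_)
open import Data.Product using (Σ; _×_; ∃)
open import Relation.Binary.PropositionalEquality using (_≡_)
open import Relation.Nullary using (¬_)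
open import Function.Definitions using (Injective)

record Graph : Set where
  field
    n     : ℕ
    adj   : Fin n → Fin n → Bool
    sym   : ∀ u v → adj u v ≡ adj v u
    irrefl : ∀ v → adj v v ≡ false
open Graph public

count : {m : ℕ} → (Fin m → Bool) → ℕ
count {zero}  P = 0
count {suc m} P = (if P fz then 1 else 0) Data.Nat.+ count (λ i → P (fs i))

VSet : Graph → Set
VSet G = Fin (n G) → Bool

degree : (G : Graph) → Fin (n G) → ℕ
degree G v = count (adj G v)

data WalkIn (G : Graph) (B : VSet G) : Fin (n G) → Fin (n G) → Set where
  here : ∀ {u} → B u ≡ true → WalkIn G B u u
  step : ∀ {u w v} → B u ≡ true → adj G u w ≡ true → WalkIn G B w v → WalkIn G B u v

Connected : (G : Graph) → VSet G → Set
Connected G B = ∃ (λ x → B x ≡ true)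
              × (∀ u v → B u ≡ true → B v ≡ true → WalkIn G B u v)

Touch : (G : Graph) → VSet G → VSet G → Set
Touch G A B = ∃ λ x → ∃ λ y → A x ≡ true × B y ≡ true × adj G x y ≡ true

record InducedMinorModelIn (G : Graph) (X : VSet G) (H : Graph) : Set where
  field
    branch    : Fin (n H) → VSet G
    inside    : ∀ a x → branch a x ≡ true → X x ≡ true
    connected : ∀ a → Connected G (branch a)
    disjoint  : ∀ a b → ¬ (a ≡ b) → ∀ x → ¬ (branch a x ≡ true × branch b x ≡ true)
    adjacency : ∀ a b → ¬ (a ≡ b) → (adj H a b ≡ true → Touch G (branch a) (branch b))
                                  × (Touch G (branch a) (branch b) → adj H a b ≡ true)

HasInducedMinorIn : (G : Graph) → VSet G → Graph → Set
HasInducedMinorIn G X H = InducedMinorModelIn G X H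

HasInducedMinor : Graph → Graph → Set
HasInducedMinor G H = HasInducedMinorIn G (λ _ → true) H

Proper : (G : Graph) → VSet G → Set
Proper G X = ∃ λ v → X v ≡ false

EdgesTouchLowDegree : Graph → Set
EdgesTouchLowDegree H = ∀ u v → adj H u v ≡ true → (degree H u ≤ 2) Data.Sum.⊎ (degree H v ≤ 2)
  where import Data.Sum

-- degeneracy(G) ≤ d : some linear ordering (given by an injective rank map)
-- in which each vertex has at most d earlier neighbours.
DegeneracyAtMost : Graph → ℕ → Set
DegeneracyAtMost G d =
  Σ (Fin (n G) → Fin (n G)) λ rank →
    Injective _≡_ _≡_ rank ×
    (∀ v → count (λ u → adj G u v ∧ (toℕ (rank u) <ᵇ toℕ (rank v))) ≤ d)

{-# OPTIONS --safe #-}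
module Submission where

open import Defs hiding (sym)
open import Data.Nat using (ℕ; zero; suc; _+_; _*_; _≤_; _<_; z≤n; s≤s; _<ᵇ_; _≤?_)
open import Data.Nat.Properties
  using (≤-refl; ≤-trans; <-trans; ≤-<-trans; <-≤-trans; ≤-pred; <-irrefl; <-asym; <-cmp; n≮n; n≮0; 1+n≰n;
         m≤n⇒m≤1+n; m≤m+n; m≤n+m; +-mono-≤; +-cancelˡ-≡; *-comm; <⇒<ᵇ; <ᵇ⇒<; +-commutativeSemigroup;
         module ≤-Reasoning)
open import Data.Fin using (Fin; toℕ; fromℕ<) renaming (zero to fz; suc to fs)
open import Data.Fin.Properties using (_≟_; suc-injective; toℕ<n; toℕ-injective; any?; ¬∀⟶∃¬; toℕ-fromℕ<)
open import Data.Bool using (Bool; true; false; _∧_; not; if_then_else_; T)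
open import Data.Bool.Properties using (∧-zeroʳ; ¬-not) renaming (_≟_ to _≟ᵇ_)
open import Data.Product using (_×_; ∃; _,_; proj₁; proj₂)
open import Data.Sum using (_⊎_; inj₁; inj₂; [_,_]′)
open import Data.Empty using (⊥; ⊥-elim)
open import Function.Base using (_∘_)
open import Function.Definitions using (Injective)
open import Relation.Binary.PropositionalEquality
  using (_≡_; _≢_; refl; sym; trans; cong; subst; subst₂)
open import Relation.Binary.Definitions using (tri<; tri≈; tri>)
open import Relation.Nullary using (¬_; ¬?; Dec; yes; no; does; contradiction; _×-dec_; _→-dec_)
open import Relation.Nullary.Decidable using (dec-true; dec-false; decidable-stable)
open import Algebra.Properties.CommutativeSemigroup +-commutativeSemigroup using (interchange)

-- Fix a model of H in G with branch sets B_a.  By minimality every vertex lies in a branch set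
-- and no branch set can be shrunk while keeping it connected and touching its neighbours.
-- Hence a vertex x ∈ B_a has at most deg_H(a) neighbours inside B_a: removing such a
-- neighbour y, the component of x in B_a − y misses some neighbouring branch set, and distinct
-- y miss distinct ones.  If deg_H(a) ≤ 2, each neighbouring branch set is attached to B_a at a
-- single vertex, so B_a has at most two "ports" (vertices with a neighbour in another branch
-- set), 2|V(H)| in total.  Since every edge of H has an end of degree ≤ 2, all outside
-- neighbours of a non-port are ports, so a non-port has degree ≤ |V(H)| + 2|V(H)|.  Listing
-- the ports first gives an ordering witnessing degeneracy ≤ 3|V(H)|.

∧-true⁻ˡ : ∀ {a b} → (a ∧ b) ≡ true → a ≡ true
∧-true⁻ˡ {true} _ = refl

∧-true⁻ʳ : ∀ {a b} → (a ∧ b) ≡ true → b ≡ true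
∧-true⁻ʳ {true} e = e

∧-true : ∀ {a b} → a ≡ true → b ≡ true → (a ∧ b) ≡ true
∧-true refl refl = refl

does-true⁻ : ∀ {p} {P : Set p} (P? : Dec P) → does P? ≡ true → P
does-true⁻ (yes p) _ = p

count-mono : ∀ {m} (f g : Fin m → Bool) → (∀ u → f u ≡ true → g u ≡ true) → count f ≤ count g
count-mono {zero} f g f⊆g = z≤n
count-mono {suc m} f g f⊆g with f fz in ef | g fz in eg
... | true  | true  = s≤s (count-mono _ _ (λ u → f⊆g (fs u)))
... | true  | false = contradiction (trans (sym eg) (f⊆g fz ef)) λ ()
... | false | true  = m≤n⇒m≤1+n (count-mono _ _ (λ u → f⊆g (fs u)))
... | false | false = count-mono _ _ (λ u → f⊆g (fs u))

count-mono-< : ∀ {m} (f g : Fin m → Bool) → (∀ u → f u ≡ true → g u ≡ true)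
  → (w : Fin m) → g w ≡ true → f w ≡ false → count f < count g
count-mono-< f g f⊆g fz gw fw rewrite gw | fw = s≤s (count-mono _ _ (λ u → f⊆g (fs u)))
count-mono-< f g f⊆g (fs w) gw fw with f fz in ef | g fz in eg
... | true  | true  = s≤s (count-mono-< _ _ (λ u → f⊆g (fs u)) w gw fw)
... | true  | false = contradiction (trans (sym eg) (f⊆g fz ef)) λ ()
... | false | true  = m≤n⇒m≤1+n (count-mono-< _ _ (λ u → f⊆g (fs u)) w gw fw)
... | false | false = count-mono-< _ _ (λ u → f⊆g (fs u)) w gw fw

count≤size : ∀ {m} (f : Fin m → Bool) → count f ≤ m
count≤size {zero} f = z≤n
count≤size {suc m} f with f fz
... | true  = s≤s (count≤size _)
... | false = m≤n⇒m≤1+n (count≤size _)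

count-none : ∀ {m} (f : Fin m → Bool) → (∀ u → f u ≡ false) → count f ≡ 0
count-none {zero} f none = refl
count-none {suc m} f none rewrite none fz = count-none _ (λ u → none (fs u))

[_] : Bool → ℕ
[ b ] = if b then 1 else 0

[]-cover : ∀ {a b c} → (a ≡ true → b ≡ true ⊎ c ≡ true) → [ a ] ≤ [ b ] + [ c ]
[]-cover {false} _ = z≤n
[]-cover {true} {true} _ = s≤s z≤n
[]-cover {true} {false} {true} _ = s≤s z≤n
[]-cover {true} {false} {false} cover with cover refl
... | inj₁ ()
... | inj₂ ()

count-cover : ∀ {m} (f g h : Fin m → Bool) → (∀ u → f u ≡ true → g u ≡ true ⊎ h u ≡ true)
  → count f ≤ count g + count h
count-cover {zero} f g h cover = z≤n
count-cover {suc m} f g h cover = begin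
  [ f fz ] + count (λ u → f (fs u))
    ≤⟨ +-mono-≤ ([]-cover (cover fz)) (count-cover _ _ _ (λ u → cover (fs u))) ⟩
  ([ g fz ] + [ h fz ]) + (count (λ u → g (fs u)) + count (λ u → h (fs u)))
    ≡⟨ interchange [ g fz ] [ h fz ] _ _ ⟩
  count g + count h ∎
  where open ≤-Reasoning

count-inject : ∀ {m k} (P : Fin m → Bool) (Q : Fin k → Bool)
  (f : ∀ u → P u ≡ true → Fin k) → (∀ u p → Q (f u p) ≡ true)
  → (∀ u v p q → f u p ≡ f v q → u ≡ v) → count P ≤ count Q
count-inject {zero} P Q f f∈Q f-inj = z≤n
count-inject {suc m} P Q f f∈Q f-inj with P fz in P0
... | false = count-inject _ Q (λ u → f (fs u)) (λ u → f∈Q (fs u))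
               (λ u v p q e → suc-injective (f-inj (fs u) (fs v) p q e))
... | true = ≤-trans (s≤s IH) (count-mono-< Q′ Q (λ u → ∧-true⁻ˡ) t (f∈Q fz P0) Q′t)
  where
  t = f fz P0
  Q′ : Fin _ → Bool
  Q′ c = Q c ∧ not (does (c ≟ t))
  Q′t : Q′ t ≡ false
  Q′t rewrite dec-true (t ≟ t) refl = ∧-zeroʳ (Q t)
  f∈Q′ : ∀ u p → Q′ (f (fs u) p) ≡ true
  f∈Q′ u p rewrite dec-false (f (fs u) p ≟ t) (λ e → contradiction (f-inj (fs u) fz p P0 e) λ ())
    = ∧-true (f∈Q (fs u) p) refl
  IH = count-inject (λ u → P (fs u)) Q′ (λ u → f (fs u)) f∈Q′
         (λ u v p q e → suc-injective (f-inj (fs u) (fs v) p q e))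

three≤count : ∀ {m} (f : Fin m → Bool) {c d e} → c ≢ d → c ≢ e → d ≢ e
  → f c ≡ true → f d ≡ true → f e ≡ true → 3 ≤ count f
three≤count f {c} {d} {e} c≢d c≢e d≢e fc fd fe = count-inject {3} (λ _ → true) f pick pick∈f pick-inj
  where
  pick : Fin 3 → true ≡ true → Fin _
  pick fz _ = c
  pick (fs fz) _ = d
  pick (fs (fs fz)) _ = e
  pick∈f : ∀ i p → f (pick i p) ≡ true
  pick∈f fz _ = fc
  pick∈f (fs fz) _ = fd
  pick∈f (fs (fs fz)) _ = fe
  pick-inj : ∀ i j p q → pick i p ≡ pick j q → i ≡ j
  pick-inj fz fz _ _ _ = refl
  pick-inj fz (fs fz) _ _ x = contradiction x c≢d
  pick-inj fz (fs (fs fz)) _ _ x = contradiction x c≢e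
  pick-inj (fs fz) fz _ _ x = contradiction (sym x) c≢d
  pick-inj (fs fz) (fs fz) _ _ _ = refl
  pick-inj (fs fz) (fs (fs fz)) _ _ x = contradiction x d≢e
  pick-inj (fs (fs fz)) fz _ _ x = contradiction (sym x) c≢e
  pick-inj (fs (fs fz)) (fs fz) _ _ x = contradiction (sym x) d≢e
  pick-inj (fs (fs fz)) (fs (fs fz)) _ _ _ = refl

∑ : ∀ {k} → (Fin k → ℕ) → ℕ
∑ {zero} f = 0
∑ {suc k} f = f fz + ∑ (λ i → f (fs i))

∑-mono-≤ : ∀ {k} (f g : Fin k → ℕ) → (∀ a → f a ≤ g a) → ∑ f ≤ ∑ g
∑-mono-≤ {zero} f g f≤g = z≤n
∑-mono-≤ {suc k} f g f≤g = +-mono-≤ (f≤g fz) (∑-mono-≤ _ _ (λ a → f≤g (fs a)))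

∑-const : ∀ {k} c → ∑ {k} (λ _ → c) ≡ k * c
∑-const {zero} c = refl
∑-const {suc k} c = cong (c +_) (∑-const {k} c)

∑-+ : ∀ {k} (f g : Fin k → ℕ) → ∑ (λ a → f a + g a) ≡ ∑ f + ∑ g
∑-+ {zero} f g = refl
∑-+ {suc k} f g = trans (cong (f fz + g fz +_) (∑-+ (λ i → f (fs i)) (λ i → g (fs i))))
                        (interchange (f fz) (g fz) _ _)

∑-≥ : ∀ {k} (f : Fin k → ℕ) a → f a ≤ ∑ f
∑-≥ f fz = m≤m+n _ _
∑-≥ f (fs a) = ≤-trans (∑-≥ (λ i → f (fs i)) a) (m≤n+m _ _)

count≤∑-fibres : ∀ {m k} (P : Fin m → Bool) (ι : Fin m → Fin k)
  → count P ≤ ∑ (λ a → count (λ v → P v ∧ does (ι v ≟ a)))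
count≤∑-fibres {zero} P ι = z≤n
count≤∑-fibres {suc m} P ι = begin
  [ P fz ] + count (λ v → P (fs v))
    ≤⟨ +-mono-≤ (single (P fz)) (count≤∑-fibres _ (λ v → ι (fs v))) ⟩
  ∑ (λ a → [ P fz ∧ does (ι fz ≟ a) ]) + ∑ (λ a → count (λ v → P (fs v) ∧ does (ι (fs v) ≟ a)))
    ≡⟨ sym (∑-+ (λ a → [ P fz ∧ does (ι fz ≟ a) ])
               (λ a → count (λ v → P (fs v) ∧ does (ι (fs v) ≟ a)))) ⟩
  ∑ (λ a → count (λ v → P v ∧ does (ι v ≟ a))) ∎
  where
  open ≤-Reasoning
  single : ∀ b → [ b ] ≤ ∑ (λ a → [ b ∧ does (ι fz ≟ a) ])
  single false = z≤n
  single true = subst (λ x → [ x ] ≤ ∑ (λ a → [ does (ι fz ≟ a) ]))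
                      (dec-true (ι fz ≟ ι fz) refl) (∑-≥ _ (ι fz))

count≤fibres*bound : ∀ {m k} (P : Fin m → Bool) (ι : Fin m → Fin k) c
  → (∀ a → count (λ v → P v ∧ does (ι v ≟ a)) ≤ c) → count P ≤ k * c
count≤fibres*bound {k = k} P ι c bound = begin
  count P                                        ≤⟨ count≤∑-fibres P ι ⟩
  ∑ (λ a → count (λ v → P v ∧ does (ι v ≟ a))) ≤⟨ ∑-mono-≤ _ _ bound ⟩
  ∑ {k} (λ _ → c)                                ≡⟨ ∑-const {k} c ⟩
  k * c                                          ∎
  where open ≤-Reasoning

<ᵇ-true : ∀ {m n} → m < n → (m <ᵇ n) ≡ true
<ᵇ-true {m} {n} m<n with m <ᵇ n | <⇒<ᵇ m<n
... | true | _ = refl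

<ᵇ-true⁻ : ∀ {m n} → (m <ᵇ n) ≡ true → m < n
<ᵇ-true⁻ {m} {n} e = <ᵇ⇒< m n (subst T (sym e) _)

module Ranking {N : ℕ} (key : Fin N → ℕ) (key-injective : ∀ u v → key u ≡ key v → u ≡ v) where

  below : Fin N → Fin N → Bool
  below v u = key u <ᵇ key v

  not-below-self : ∀ v → below v v ≡ false
  not-below-self v = ¬-not λ e → n≮n (key v) (<ᵇ-true⁻ e)

  position : Fin N → ℕ
  position v = count (below v)

  position-mono : ∀ u v → key u < key v → position u < position v
  position-mono u v ku<kv = count-mono-< (below u) (below v)
    (λ w w<u → <ᵇ-true (<-trans (<ᵇ-true⁻ w<u) ku<kv)) u (<ᵇ-true ku<kv) (not-below-self u)

  position<N : ∀ v → position v < N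
  position<N v = ≤-trans (count-mono-< (below v) (λ _ → true) (λ _ _ → refl) v refl (not-below-self v))
                         (count≤size _)

  rank : Fin N → Fin N
  rank v = fromℕ< (position<N v)

  toℕ-rank : ∀ v → toℕ (rank v) ≡ position v
  toℕ-rank v = toℕ-fromℕ< (position<N v)

  rank-reflects : ∀ u v → toℕ (rank u) < toℕ (rank v) → key u < key v
  rank-reflects u v r<r with <-cmp (key u) (key v)
  ... | tri< ku<kv _ _ = ku<kv
  ... | tri≈ _ ku≡kv _ rewrite key-injective u v ku≡kv = contradiction r<r (n≮n _)
  ... | tri> _ _ kv<ku = contradiction (position-mono v u kv<ku)
                           (<-asym (subst₂ _<_ (toℕ-rank u) (toℕ-rank v) r<r))

  rank-injective : Injective _≡_ _≡_ rank
  rank-injective {u} {v} r≡r with <-cmp (key u) (key v)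
  ... | tri< ku<kv _ _ = contradiction (position-mono u v ku<kv) (<-irrefl p≡p)
    where p≡p = trans (sym (toℕ-rank u)) (trans (cong toℕ r≡r) (toℕ-rank v))
  ... | tri≈ _ ku≡kv _ = key-injective u v ku≡kv
  ... | tri> _ _ kv<ku = contradiction (position-mono v u kv<ku) (<-irrefl p≡p)
    where p≡p = trans (sym (toℕ-rank v)) (trans (cong toℕ (sym r≡r)) (toℕ-rank u))

-- Order the vertices of P first: a vertex of P then has only P-vertices before it.
degeneracy≤ : (G : Graph) (P : VSet G) (d : ℕ)
  → count P ≤ d → (∀ v → P v ≡ false → degree G v ≤ d) → DegeneracyAtMost G d
degeneracy≤ G P d #P≤d degree≤d = rank , rank-injective , earlier≤d
  where
  key : Fin (n G) → ℕ
  key v = if P v then toℕ v else n G + toℕ v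

  key-injective : ∀ u v → key u ≡ key v → u ≡ v
  key-injective u v ku≡kv with P u | P v
  ... | true  | true  = toℕ-injective ku≡kv
  ... | false | false = toℕ-injective (+-cancelˡ-≡ (n G) _ _ ku≡kv)
  ... | true  | false = contradiction (≤-trans (toℕ<n u) (m≤m+n (n G) (toℕ v))) (<-irrefl ku≡kv)
  ... | false | true  = contradiction (≤-trans (toℕ<n v) (m≤m+n (n G) (toℕ u))) (<-irrefl (sym ku≡kv))

  open Ranking key key-injective

  P-first : ∀ u v → P v ≡ true → key u < key v → P u ≡ true
  P-first u v Pv ku<kv with P u
  ... | true = refl
  ... | false rewrite Pv =
    contradiction (≤-<-trans (m≤m+n (n G) (toℕ u)) (<-trans ku<kv (toℕ<n v))) (n≮n (n G))

  earlier≤d : ∀ v → count (λ u → adj G u v ∧ (toℕ (rank u) <ᵇ toℕ (rank v))) ≤ d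
  earlier≤d v = split (P v) refl
    where
    split : ∀ b → P v ≡ b → count (λ u → adj G u v ∧ (toℕ (rank u) <ᵇ toℕ (rank v))) ≤ d
    split true Pv = ≤-trans (count-mono _ P λ u e →
                              P-first u v Pv (rank-reflects u v (<ᵇ-true⁻ (∧-true⁻ʳ e))))
                            #P≤d
    split false Pv = ≤-trans (count-mono _ (adj G v) λ u e → trans (Graph.sym G v u) (∧-true⁻ˡ e))
                             (degree≤d v Pv)

module Walks (G : Graph) where

  V : Set
  V = Fin (n G)

  adj⇒≢ : ∀ {x y} → adj G x y ≡ true → x ≢ y
  adj⇒≢ {x} xy refl = contradiction (trans (sym xy) (irrefl G x)) λ ()

  _∖_ : VSet G → V → VSet G
  (B ∖ y) w = B w ∧ not (does (w ≟ y))

  ∖-⊆ : ∀ B y w → (B ∖ y) w ≡ true → B w ≡ true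
  ∖-⊆ B y w = ∧-true⁻ˡ

  ∉-∖-self : ∀ B y → (B ∖ y) y ≡ false
  ∉-∖-self B y rewrite dec-true (y ≟ y) refl = ∧-zeroʳ (B y)

  ∖-≢ : ∀ B y w → (B ∖ y) w ≡ true → w ≢ y
  ∖-≢ B y w e refl = contradiction (trans (sym (∉-∖-self B w)) e) λ ()

  ∈-∖ : ∀ B y {w} → B w ≡ true → w ≢ y → (B ∖ y) w ≡ true
  ∈-∖ B y {w} Bw w≢y rewrite dec-false (w ≟ y) w≢y = ∧-true Bw refl

  walk-start : ∀ {B u v} → WalkIn G B u v → B u ≡ true
  walk-start (here Bu) = Bu
  walk-start (step Bu _ _) = Bu

  walk-end : ∀ {B u v} → WalkIn G B u v → B v ≡ true
  walk-end (here Bv) = Bv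
  walk-end (step _ _ p) = walk-end p

  walk-mono : ∀ {B B′ u v} → (∀ x → B x ≡ true → B′ x ≡ true) → WalkIn G B u v → WalkIn G B′ u v
  walk-mono B⊆B′ (here Bu) = here (B⊆B′ _ Bu)
  walk-mono B⊆B′ (step Bu uw p) = step (B⊆B′ _ Bu) uw (walk-mono B⊆B′ p)

  _++ʷ_ : ∀ {B u v w} → WalkIn G B u v → WalkIn G B v w → WalkIn G B u w
  here _ ++ʷ q = q
  step Bu uw p ++ʷ q = step Bu uw (p ++ʷ q)

  walk-snoc : ∀ {B u v w} → WalkIn G B u v → adj G v w ≡ true → B w ≡ true → WalkIn G B u w
  walk-snoc p vw Bw = p ++ʷ step (walk-end p) vw (here Bw)

  walk-reverse : ∀ {B u v} → WalkIn G B u v → WalkIn G B v u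
  walk-reverse (here Bu) = here Bu
  walk-reverse {u = u} (step {w = w} Bu uw p) = walk-snoc (walk-reverse p) (trans (Graph.sym G w u) uw) Bu

  last-visit : ∀ {B u z} → WalkIn G B u z → (y : V) →
    WalkIn G (B ∖ y) u z ⊎ (z ≡ y ⊎ ∃ λ w → adj G y w ≡ true × WalkIn G (B ∖ y) w z)
  last-visit {B} {u} (here Bu) y with u ≟ y
  ... | yes u≡y = inj₂ (inj₁ u≡y)
  ... | no u≢y = inj₁ (here (∈-∖ B y Bu u≢y))
  last-visit {B} {u} (step {w = w} Bu uw p) y with last-visit p y
  ... | inj₂ tail = inj₂ tail
  ... | inj₁ q with u ≟ y
  ...   | yes refl = inj₂ (inj₂ (w , uw , q))
  ...   | no u≢y = inj₁ (step (∈-∖ B y Bu u≢y) uw q)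

  first-hit : ∀ {B s z} u u′ → u ≢ u′ → WalkIn G B s z → z ≡ u ⊎ z ≡ u′ →
    WalkIn G (B ∖ u′) s u ⊎ WalkIn G (B ∖ u) s u′
  first-hit {B} u u′ u≢u′ (here Bz) (inj₁ refl) = inj₁ (here (∈-∖ B u′ Bz u≢u′))
  first-hit {B} u u′ u≢u′ (here Bz) (inj₂ refl) = inj₂ (here (∈-∖ B u Bz (u≢u′ ∘ sym)))
  first-hit {B} {s} u u′ u≢u′ (step Bs sw p) z∈ with s ≟ u | s ≟ u′
  ... | yes refl | _ = inj₁ (here (∈-∖ B u′ Bs u≢u′))
  ... | no _ | yes refl = inj₂ (here (∈-∖ B u Bs (u≢u′ ∘ sym)))
  ... | no s≢u | no s≢u′ with first-hit u u′ u≢u′ p z∈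
  ...   | inj₁ q = inj₁ (step (∈-∖ B u′ Bs s≢u′) sw q)
  ...   | inj₂ q = inj₂ (step (∈-∖ B u Bs s≢u) sw q)

  detour : ∀ {B x y y′ z} → y ≢ y′ → B y ≡ true → B y′ ≡ true
    → adj G x y ≡ true → adj G x y′ ≡ true
    → WalkIn G B x z → WalkIn G (B ∖ y) x z ⊎ WalkIn G (B ∖ y′) x z
  detour {B} {x} {y} {y′} y≢y′ By By′ xy xy′ p with last-visit p y
  ... | inj₁ q = inj₁ q
  ... | inj₂ (inj₁ refl) = inj₂ (step x∈B∖y′ xy (here y∈B∖y′))
    where
    x∈B∖y′ = ∈-∖ B y′ (walk-start p) (adj⇒≢ xy′)
    y∈B∖y′ = ∈-∖ B y′ By y≢y′
  ... | inj₂ (inj₂ (w , yw , q)) with last-visit q y′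
  ...   | inj₁ q′ = inj₂ (step x∈B∖y′ xy (step y∈B∖y′ yw (walk-mono forget-y q′)))
    where
    x∈B∖y′ = ∈-∖ B y′ (walk-start p) (adj⇒≢ xy′)
    y∈B∖y′ = ∈-∖ B y′ By y≢y′
    forget-y : ∀ v → ((B ∖ y) ∖ y′) v ≡ true → (B ∖ y′) v ≡ true
    forget-y v e = ∈-∖ B y′ (∖-⊆ B y v (∖-⊆ (B ∖ y) y′ v e)) (∖-≢ (B ∖ y) y′ v e)
  ...   | inj₂ (inj₁ refl) = inj₁ (step x∈B∖y xy′ (here y′∈B∖y))
    where
    x∈B∖y = ∈-∖ B y (walk-start p) (adj⇒≢ xy)
    y′∈B∖y = ∈-∖ B y By′ (y≢y′ ∘ sym)
  ...   | inj₂ (inj₂ (w′ , y′w′ , q′)) = inj₁ (step x∈B∖y xy′ (step y′∈B∖y y′w′ (walk-mono (∖-⊆ (B ∖ y) y′) q′)))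
    where
    x∈B∖y = ∈-∖ B y (walk-start p) (adj⇒≢ xy)
    y′∈B∖y = ∈-∖ B y By′ (y≢y′ ∘ sym)

  -- The fuel k bounds the size of B; each step removes the current vertex from B.
  walk?-bounded : ∀ k B → count B ≤ k → ∀ u v → Dec (WalkIn G B u v)
  walk?-bounded k B #B≤k u v with B u in Bu
  ... | false = no λ p → contradiction (trans (sym Bu) (walk-start p)) λ ()
  ... | true with u ≟ v
  ...   | yes refl = yes (here Bu)
  ...   | no u≢v with k | count-mono-< (B ∖ u) B (∖-⊆ B u) u Bu (∉-∖-self B u)
  ...     | zero | #B∖u<#B = contradiction (<-≤-trans #B∖u<#B #B≤k) (n≮0)
  ...     | suc k′ | #B∖u<#B
    with any? (λ w → (adj G u w ≟ᵇ true) ×-dec walk?-bounded k′ (B ∖ u) (≤-pred (<-≤-trans #B∖u<#B #B≤k)) w v)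
  ...       | yes (w , uw , q) = yes (step Bu uw (walk-mono (∖-⊆ B u) q))
  ...       | no ∄w = no λ p → leave (last-visit p u)
    where
    leave : _ → ⊥
    leave (inj₁ q) = contradiction (trans (sym (walk-start q)) (∉-∖-self B u)) λ ()
    leave (inj₂ (inj₁ v≡u)) = u≢v (sym v≡u)
    leave (inj₂ (inj₂ w,uw,q)) = ∄w w,uw,q

  walk? : ∀ B u v → Dec (WalkIn G B u v)
  walk? B = walk?-bounded (count B) B ≤-refl

  component : VSet G → V → VSet G
  component B x v = does (walk? B x v)

  component-walk : ∀ B x {v} → component B x v ≡ true → WalkIn G B x v
  component-walk B x {v} = does-true⁻ (walk? B x v)

  walk⇒∈component : ∀ {B x v} → WalkIn G B x v → component B x v ≡ true
  walk⇒∈component {B} {x} {v} = dec-true (walk? B x v)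

  component-⊆ : ∀ B x v → component B x v ≡ true → B v ≡ true
  component-⊆ B x v = walk-end ∘ component-walk B x

  walk-in-component : ∀ {B x s v} → WalkIn G B x s → WalkIn G B s v → WalkIn G (component B x) s v
  walk-in-component p (here Bs) = here (walk⇒∈component p)
  walk-in-component p (step Bs sw q) =
    step (walk⇒∈component p) sw (walk-in-component (walk-snoc p sw (walk-start q)) q)

  component-connected : ∀ B x → B x ≡ true → Connected G (component B x)
  component-connected B x Bx = (x , walk⇒∈component x∼x) , λ u v xu xv →
    walk-reverse (walk-in-component x∼x (component-walk B x xu))
      ++ʷ walk-in-component x∼x (component-walk B x xv)
    where
    x∼x : WalkIn G B x x
    x∼x = here Bx

  touch? : ∀ A B → Dec (Touch G A B)
  touch? A B = any? λ x → any? λ y → (A x ≟ᵇ true) ×-dec ((B y ≟ᵇ true) ×-dec (adj G x y ≟ᵇ true))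

  touch-sym : ∀ {A B} → Touch G A B → Touch G B A
  touch-sym (x , y , Ax , By , xy) = y , x , By , Ax , trans (Graph.sym G y x) xy

  touch-mono : ∀ {A B A′ B′} → (∀ x → A x ≡ true → A′ x ≡ true) → (∀ x → B x ≡ true → B′ x ≡ true)
    → Touch G A B → Touch G A′ B′
  touch-mono A⊆A′ B⊆B′ (x , y , Ax , By , xy) = x , y , A⊆A′ x Ax , B⊆B′ y By , xy

neighbours-of-degree≤2 : ∀ (H : Graph) {a c d} → degree H a ≤ 2 → c ≢ d
  → adj H a c ≡ true → adj H a d ≡ true → ∀ e → adj H a e ≡ true → e ≡ c ⊎ e ≡ d
neighbours-of-degree≤2 H {a} {c} {d} deg≤2 c≢d ac ad e ae with e ≟ c | e ≟ d
... | yes e≡c | _ = inj₁ e≡c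
... | no _ | yes e≡d = inj₂ e≡d
... | no e≢c | no e≢d =
  contradiction (≤-trans (three≤count (adj H a) c≢d (e≢c ∘ sym) (e≢d ∘ sym) ac ad ae) deg≤2) (1+n≰n {2})

module MinimalModel (H G : Graph) (M : HasInducedMinor G H)
  (minimal : ∀ X → Proper G X → ¬ HasInducedMinorIn G X H) where

  open InducedMinorModelIn M
  open Walks G
  open Walks H using () renaming (adj⇒≢ to adjᴴ⇒≢)

  VH : Set
  VH = Fin (n H)

  edge⇒touch : ∀ {a b} → adj H a b ≡ true → Touch G (branch a) (branch b)
  edge⇒touch ab = proj₁ (adjacency _ _ (adjᴴ⇒≢ ab)) ab

  touch⇒edge : ∀ {a b} → a ≢ b → Touch G (branch a) (branch b) → adj H a b ≡ true
  touch⇒edge a≢b = proj₂ (adjacency _ _ a≢b)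

  no-submodel-avoiding : (β : VH → VSet G) → (∀ a x → β a x ≡ true → branch a x ≡ true)
    → (∀ a → Connected G (β a)) → (∀ a b → adj H a b ≡ true → Touch G (β a) (β b))
    → ∀ y → (∀ a → β a y ≡ false) → ⊥
  no-submodel-avoiding β β⊆ β-connected β-edges y y∉β =
    minimal (everything ∖ y) (y , ∉-∖-self everything y) record
      { branch = β
      ; inside = λ a x x∈β → ∈-∖ everything y {x} refl λ { refl → contradiction (trans (sym x∈β) (y∉β a)) λ () }
      ; connected = β-connected
      ; disjoint = λ a b a≢b x (x∈a , x∈b) → disjoint a b a≢b x (β⊆ a x x∈a , β⊆ b x x∈b)
      ; adjacency = λ a b a≢b → β-edges a b , λ t → touch⇒edge a≢b (touch-mono (β⊆ a) (β⊆ b) t)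
      }
    where
    everything : VSet G
    everything _ = true

  covered : ∀ v → ∃ λ a → branch a v ≡ true
  covered v with any? (λ a → branch a v ≟ᵇ true)
  ... | yes a,v∈a = a,v∈a
  ... | no ∄a = ⊥-elim (no-submodel-avoiding branch (λ _ _ x∈a → x∈a) connected (λ _ _ → edge⇒touch) v
                  (λ a → ¬-not λ v∈a → ∄a (a , v∈a)))

  home : V → VH
  home v = proj₁ (covered v)

  ∈-home : ∀ v → branch (home v) v ≡ true
  ∈-home v = proj₂ (covered v)

  home-unique : ∀ {a v} → branch a v ≡ true → home v ≡ a
  home-unique {a} {v} v∈a with home v ≟ a
  ... | yes home≡a = home≡a
  ... | no home≢a = contradiction (∈-home v , v∈a) (disjoint _ a home≢a v)

  -- Replacing branch a by S frees the vertex y.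
  branch-unshrinkable : ∀ a y (S : VSet G) → branch a y ≡ true
    → (∀ x → S x ≡ true → (branch a ∖ y) x ≡ true) → Connected G S
    → (∀ c → adj H a c ≡ true → Touch G S (branch c)) → ⊥
  branch-unshrinkable a y S y∈a S⊆a∖y S-connected S-touches =
    no-submodel-avoiding β β⊆ β-connected β-edges y y∉β
    where
    β : VH → VSet G
    β b = if does (b ≟ a) then S else branch b
    β⊆ : ∀ b x → β b x ≡ true → branch b x ≡ true
    β⊆ b x x∈b with b ≟ a
    ... | yes refl = ∖-⊆ (branch a) y x (S⊆a∖y x x∈b)
    ... | no _ = x∈b
    β-connected : ∀ b → Connected G (β b)
    β-connected b with b ≟ a
    ... | yes refl = S-connected
    ... | no _ = connected b
    β-edges : ∀ b c → adj H b c ≡ true → Touch G (β b) (β c)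
    β-edges b c bc with b ≟ a | c ≟ a
    ... | yes refl | yes refl = contradiction refl (adjᴴ⇒≢ bc)
    ... | yes refl | no _ = S-touches c bc
    ... | no _ | yes refl = touch-sym (S-touches b (trans (Graph.sym H a b) bc))
    ... | no _ | no _ = edge⇒touch bc
    y∉β : ∀ b → β b y ≡ false
    y∉β b with b ≟ a
    ... | yes refl = ¬-not λ y∈S → ∖-≢ (branch a) y y (S⊆a∖y y y∈S) refl
    ... | no b≢a = ¬-not λ y∈b → disjoint b a b≢a y (y∈b , y∈a)

  untouched-neighbour : ∀ a y (S : VSet G) → branch a y ≡ true
    → (∀ x → S x ≡ true → (branch a ∖ y) x ≡ true) → Connected G S
    → ∃ λ c → adj H a c ≡ true × ¬ Touch G S (branch c)
  untouched-neighbour a y S y∈a S⊆a∖y S-connected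
    with ¬∀⟶∃¬ (n H) _ (λ c → (adj H a c ≟ᵇ true) →-dec touch? S (branch c))
                 (branch-unshrinkable a y S y∈a S⊆a∖y S-connected)
  ... | c , ¬[ac→touch] with adj H a c ≟ᵇ true
  ...   | yes ac = c , ac , λ t → ¬[ac→touch] λ _ → t
  ...   | no ¬ac = contradiction (λ ac → contradiction ac ¬ac) ¬[ac→touch]

  -- Deleting an inner neighbour y of x leaves a component of x missing some neighbouring
  -- branch set, and different y miss different ones.
  inner-degree≤ : ∀ a x → branch a x ≡ true → count (λ y → adj G x y ∧ branch a y) ≤ degree H a
  inner-degree≤ a x x∈a = count-inject _ (adj H a) missed missed-adj missed-injective
    where
    B = branch a
    Inner : V → Set
    Inner y = (adj G x y ∧ B y) ≡ true

    C : V → VSet G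
    C y = component (B ∖ y) x

    missing : ∀ y → Inner y → ∃ λ c → adj H a c ≡ true × ¬ Touch G (C y) (branch c)
    missing y xy∈B = untouched-neighbour a y (C y) (∧-true⁻ʳ xy∈B) (component-⊆ (B ∖ y) x)
      (component-connected (B ∖ y) x (∈-∖ B y x∈a (adj⇒≢ (∧-true⁻ˡ xy∈B))))

    missed : ∀ y → Inner y → VH
    missed y xy∈B = proj₁ (missing y xy∈B)

    missed-adj : ∀ y xy∈B → adj H a (missed y xy∈B) ≡ true
    missed-adj y xy∈B = proj₁ (proj₂ (missing y xy∈B))

    missed-injective : ∀ y y′ xy∈B xy′∈B → missed y xy∈B ≡ missed y′ xy′∈B → y ≡ y′
    missed-injective y y′ xy∈B xy′∈B same with y ≟ y′
    ... | yes y≡y′ = y≡y′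
    ... | no y≢y′ with edge⇒touch (missed-adj y xy∈B)
    ...   | z , z′ , z∈a , z′∈c , zz′
      with detour y≢y′ (∧-true⁻ʳ xy∈B) (∧-true⁻ʳ xy′∈B) (∧-true⁻ˡ xy∈B) (∧-true⁻ˡ xy′∈B)
                  (proj₂ (connected a) x z x∈a z∈a)
    ...     | inj₁ q = ⊥-elim (proj₂ (proj₂ (missing y xy∈B)) (z , z′ , walk⇒∈component q , z′∈c , zz′))
    ...     | inj₂ q = ⊥-elim (proj₂ (proj₂ (missing y′ xy′∈B))
                         (z , z′ , walk⇒∈component q , subst (λ c → branch c z′ ≡ true) same z′∈c , zz′))

  -- Otherwise a component of branch a avoiding one of two attachment vertices could replace it.
  single-attachment : ∀ {a c} → degree H a ≤ 2 → a ≢ c → ∀ {v v′ u u′}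
    → branch a v ≡ true → branch a v′ ≡ true → branch c u ≡ true → branch c u′ ≡ true
    → adj G v u ≡ true → adj G v′ u′ ≡ true → v ≡ v′
  single-attachment {a} {c} deg≤2 a≢c {v} {v′} {u} {u′} v∈a v′∈a u∈c u′∈c vu v′u′ with v ≟ v′
  ... | yes v≡v′ = v≡v′
  ... | no v≢v′ = ⊥-elim (separate other-neighbour)
    where
    ac : adj H a c ≡ true
    ac = touch⇒edge a≢c (v , u , v∈a , u∈c , vu)

    other-neighbour : ∃ λ d → (∀ e → adj H a e ≡ true → e ≡ c ⊎ e ≡ d) × Touch G (branch a) (branch d)
    other-neighbour with any? (λ d → (adj H a d ≟ᵇ true) ×-dec ¬? (d ≟ c))
    ... | yes (d , ad , d≢c) = d , neighbours-of-degree≤2 H deg≤2 (d≢c ∘ sym) ac ad , edge⇒touch ad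
    ... | no ∄d = c , (λ e ae → inj₁ (decidable-stable (e ≟ c) λ e≢c → ∄d (e , ae , e≢c)))
                    , (v , u , v∈a , u∈c , vu)

    separate : (∃ λ d → (∀ e → adj H a e ≡ true → e ≡ c ⊎ e ≡ d) × Touch G (branch a) (branch d)) → ⊥
    separate (d , a-nbrs , w , w′ , w∈a , w′∈d , ww′) =
      [ shrink v′∈a vu u∈c , shrink v∈a v′u′ u′∈c ]′
        (first-hit v v′ v≢v′ (proj₂ (connected a) w v w∈a v∈a) (inj₁ refl))
      where
      shrink : ∀ {y t t′} → branch a y ≡ true → adj G t t′ ≡ true → branch c t′ ≡ true
             → WalkIn G (branch a ∖ y) w t → ⊥
      shrink {y} y∈a tt′ t′∈c q = branch-unshrinkable a y S y∈a (component-⊆ (branch a ∖ y) w)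
          (component-connected (branch a ∖ y) w (walk-start q)) S-touches
        where
        S : VSet G
        S = component (branch a ∖ y) w
        S-touches : ∀ e → adj H a e ≡ true → Touch G S (branch e)
        S-touches e ae with a-nbrs e ae
        ... | inj₁ refl = _ , _ , walk⇒∈component q , t′∈c , tt′
        ... | inj₂ refl = w , w′ , walk⇒∈component {branch a ∖ y} (here (walk-start q)) , w′∈d , ww′

  IsPort : V → Set
  IsPort v = degree H (home v) ≤ 2 × ∃ λ u → adj G v u ≡ true × home u ≢ home v

  isPort? : ∀ v → Dec (IsPort v)
  isPort? v = (degree H (home v) ≤? 2) ×-dec any? λ u → (adj G v u ≟ᵇ true) ×-dec ¬? (home u ≟ home v)

  port : V → Bool
  port v = does (isPort? v)

  ports-per-branch : ∀ a → count (λ v → port v ∧ does (home v ≟ a)) ≤ 2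
  ports-per-branch a with degree H a ≤? 2
  ... | yes deg≤2 = ≤-trans (count-inject _ (adj H a) far-branch far-adj far-injective) deg≤2
    where
    InFibre : V → Set
    InFibre v = (port v ∧ does (home v ≟ a)) ≡ true
    port-of : ∀ v → InFibre v → IsPort v
    port-of v p = does-true⁻ (isPort? v) (∧-true⁻ˡ p)
    home≡a : ∀ v → InFibre v → home v ≡ a
    home≡a v p = does-true⁻ (home v ≟ a) (∧-true⁻ʳ {port v} p)
    far-branch : ∀ v → InFibre v → VH
    far-branch v p = home (proj₁ (proj₂ (port-of v p)))
    far-adj : ∀ v p → adj H a (far-branch v p) ≡ true
    far-adj v p with port-of v p
    ... | _ , u , vu , u∉ = subst (λ b → adj H b (home u) ≡ true) (home≡a v p)
                                  (touch⇒edge (u∉ ∘ sym) (v , u , ∈-home v , ∈-home u , vu))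
    far-injective : ∀ v v′ p p′ → far-branch v p ≡ far-branch v′ p′ → v ≡ v′
    far-injective v v′ p p′ same with port-of v p | port-of v′ p′
    ... | deg≤2 , u , vu , u∉ | _ , u′ , v′u′ , _ =
      single-attachment deg≤2 (u∉ ∘ sym) (∈-home v) v′∈home-v (∈-home u) u′∈home-u vu v′u′
      where
      v′∈home-v = subst (λ b → branch b v′ ≡ true) (trans (home≡a v′ p′) (sym (home≡a v p))) (∈-home v′)
      u′∈home-u = subst (λ b → branch b u′ ≡ true) (sym same) (∈-home u′)
  ... | no deg≰2 = subst (_≤ 2) (sym (count-none _ no-port)) z≤n
    where
    no-port : ∀ v → (port v ∧ does (home v ≟ a)) ≡ false
    no-port v = ¬-not λ p → deg≰2 (subst (λ b → degree H b ≤ 2) (does-true⁻ (home v ≟ a) (∧-true⁻ʳ {port v} p))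
                                         (proj₁ (does-true⁻ (isPort? v) (∧-true⁻ˡ p))))

  ports≤ : count port ≤ 2 * n H
  ports≤ = subst (count port ≤_) (*-comm (n H) 2) (count≤fibres*bound port home 2 ports-per-branch)

  module _ (low : EdgesTouchLowDegree H) where

    -- The edge vu joins two branch sets, so one of their branch vertices has degree ≤ 2;
    -- it is not home v, as v is no port, hence u is a port.
    outer-neighbours-are-ports : ∀ v u → port v ≡ false → adj G v u ≡ true
      → branch (home v) u ≡ false → port u ≡ true
    outer-neighbours-are-ports v u v-not-port vu u∉home-v =
      dec-true (isPort? u) (u-low , v , trans (Graph.sym G u v) vu , homes-differ ∘ sym)
      where
      homes-differ : home u ≢ home v
      homes-differ home-u≡home-v = contradiction (subst (λ b → branch b u ≡ true) home-u≡home-v (∈-home u))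
                                                 (λ u∈ → contradiction (trans (sym u∈) u∉home-v) λ ())
      u-low : degree H (home u) ≤ 2
      u-low with low (home v) (home u) (touch⇒edge (homes-differ ∘ sym) (v , u , ∈-home v , ∈-home u , vu))
      ... | inj₂ u-low = u-low
      ... | inj₁ v-low = contradiction (dec-true (isPort? v) (v-low , u , vu , homes-differ))
                                       (λ v-port → contradiction (trans (sym v-port) v-not-port) λ ())

    non-port-degree≤ : ∀ v → port v ≡ false → degree G v ≤ n H + 2 * n H
    non-port-degree≤ v v-not-port = begin
      degree G v                                                 ≤⟨ count-cover _ _ _ inner-or-port ⟩
      count (λ u → adj G v u ∧ branch (home v) u) + count port  ≤⟨ +-mono-≤ inner≤ ports≤ ⟩
      n H + 2 * n H                                              ∎
      where
      open ≤-Reasoning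
      inner≤ : count (λ u → adj G v u ∧ branch (home v) u) ≤ n H
      inner≤ = ≤-trans (inner-degree≤ (home v) v (∈-home v)) (count≤size (adj H (home v)))
      inner-or-port : ∀ u → adj G v u ≡ true → (adj G v u ∧ branch (home v) u) ≡ true ⊎ port u ≡ true
      inner-or-port u vu with branch (home v) u in u∈?
      ... | true = inj₁ (∧-true vu refl)
      ... | false = inj₂ (outer-neighbours-are-ports v u v-not-port vu u∈?)

    degeneracy≤3|H| : DegeneracyAtMost G (3 * n H)
    degeneracy≤3|H| = degeneracy≤ G port (3 * n H) (≤-trans ports≤ (m≤n+m _ (n H))) non-port-degree≤

lemma21 : (H G : Graph) → EdgesTouchLowDegree H → HasInducedMinor G H
    → (∀ X → Proper G X → ¬ HasInducedMinorIn G X H)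
    → DegeneracyAtMost G (3 * n H)
lemma21 H G low M minimal = MinimalModel.degeneracy≤3|H| H G M minimal low
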